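{- Let $x$ be a partial order and for each $i\in x$ let $x_i$ be a partial order. Let $y\in\{2^{<\omega},-2^{<\omega},2^{<\omega}_\perp\}$, and suppose $y$ does not order-embed into $x$ nor into any $x_i$. Then $y$ does not order-embed into $\sum_{i\in x}x_i$.
   Context: Order embedding: $a\le b\iff\varphi(a)\le\varphi(b)$. The $x$-sum $\sum_{i\in x}x_i$ is the disjoint union ordered by $a\le b$ iff $a,b\in x_i$ with $a\le_{x_i}b$, or $a\in x_i$, $b\in x_j$ with $i<_xj$. $2^{<\omega}$: finite $0$-$1$ sequences ordered by initial segment; $-2^{<\omega}$: its reverse; $2^{<\omega}_\perp$: finite $0$-$1$ sequences with $s<t$ iff $s=u^\frown\langle0\rangle^\frown s'$ and $t=u^\frown\langle1\rangle^\frown t'$ for some sequences $u,s',t'$. -}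

module Defs where

open import Level using (Level; _⊔_; suc; 0ℓ)
open import Data.Bool using (Bool; true; false)
open import Data.List using (List; []; _∷_; _++_)
open import Data.Product using (Σ; ∃; ∃-syntax; _×_; _,_)
open import Data.Sum using (_⊎_)
open import Function using (flip)
open import Function.Bundles using (_⇔_)
open import Relation.Binary.Core using (Rel)
open import Relation.Binary.Structures using (IsPartialOrder)
open import Relation.Binary.PropositionalEquality using (_≡_)
open import Relation.Nullary using (¬_)
open import Data.List.Relation.Binary.Prefix.Heterogeneous using (Prefix)

record PartialOrder (a ℓ : Level) : Set (suc (a ⊔ ℓ)) where
  field
    Carrier        : Set a
    _≤_            : Rel Carrier ℓ
    isPartialOrder : IsPartialOrder _≡_ _≤_

open PartialOrder public

OrderEmbeds : ∀ {a b ℓ₁ ℓ₂} {A : Set a} {B : Set b} →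
              Rel A ℓ₁ → Rel B ℓ₂ → Set (a ⊔ b ⊔ ℓ₁ ⊔ ℓ₂)
OrderEmbeds {A = A} {B = B} _≤A_ _≤B_ =
  Σ (A → B) λ φ → ∀ a a′ → (a ≤A a′) ⇔ (φ a ≤B φ a′)

SumCarrier : ∀ {a ℓ} (x : PartialOrder a ℓ) (X : Carrier x → PartialOrder a ℓ) → Set a
SumCarrier x X = Σ (Carrier x) λ i → Carrier (X i)

data SumLe {a ℓ} (x : PartialOrder a ℓ) (X : Carrier x → PartialOrder a ℓ) :
           SumCarrier x X → SumCarrier x X → Set (a ⊔ ℓ) where
  inside : ∀ {i p q} → _≤_ (X i) p q → SumLe x X (i , p) (i , q)
  across : ∀ {i j p q} → _≤_ x i j → ¬ (i ≡ j) → SumLe x X (i , p) (j , q)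

TreeLe : Rel (List Bool) 0ℓ
TreeLe = Prefix _≡_

RevTreeLe : Rel (List Bool) 0ℓ
RevTreeLe = flip TreeLe

PerpLt : Rel (List Bool) 0ℓ
PerpLt s t = ∃[ u ] ∃[ s′ ] ∃[ t′ ]
  (s ≡ u ++ (false ∷ s′)) × (t ≡ u ++ (true ∷ t′))

PerpLe : Rel (List Bool) 0ℓ
PerpLe s t = s ≡ t ⊎ PerpLt s t

data WhichY : Set where
  tree revTree perp : WhichY

YLe : WhichY → Rel (List Bool) 0ℓ
YLe tree    = TreeLe
YLe revTree = RevTreeLe
YLe perp    = PerpLe

-- Let φ embed y into the sum and write π s for the summand containing φ s. If π is
-- injective it is itself an embedding of y into x, since distinct summands are
-- compared by their indices. Otherwise two distinct sequences share a summand, and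
-- comparing them with suitable third points shows that a whole cone {a ⌢ e} lies in
-- one summand x_i; since y is isomorphic to each of its cones, y embeds into x_i.
-- The case -2^{<ω} is the case 2^{<ω} for the dual orders.
module Submission where

open import Defs
open import Level using (Level; _⊔_)
open import Data.Bool using (Bool; true; false; not)
open import Data.Bool.Properties using (not-¬) renaming (_≟_ to _≟ᵇ_)
open import Data.Empty using (⊥-elim)
open import Data.List using (List; []; _∷_; _++_)
open import Data.List.Properties using (++-assoc; ++-cancelˡ; ++-identityʳ-unique; ∷-injective; ≡-dec)
import Data.List.Relation.Binary.Pointwise as Pointwise
open import Data.List.Relation.Binary.Prefix.Heterogeneous using ([]; _∷_)
open import Data.List.Relation.Binary.Prefix.Heterogeneous.Properties using (fromPointwise; ++⁺; ++⁻)
open import Data.Product using (_,_; proj₁; proj₂)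
open import Data.Sum using (_⊎_; inj₁; inj₂)
open import Function using (_∘_; flip)
open import Function.Bundles using (_⇔_; mk⇔; Equivalence)
import Function.Properties.Equivalence as ⇔
open import Relation.Binary.Core using (Rel)
open import Relation.Binary.Structures using (IsPartialOrder)
open import Relation.Binary.Definitions using (Reflexive; DecidableEquality)
open import Relation.Binary.PropositionalEquality using (_≡_; _≢_; refl; sym; trans; cong)
import Relation.Binary.Construct.Flip.EqAndOrd as Flip
open import Relation.Nullary using (¬_; yes; no)

open Equivalence

private
  variable
    a ℓ c r : Level
    b : Bool
    s t u : List Bool

TreeLe-++ : ∀ s e → TreeLe s (s ++ e)
TreeLe-++ []      e = []
TreeLe-++ (_ ∷ s) e = refl ∷ TreeLe-++ s e

TreeLe-cone : ∀ a e e′ → TreeLe e e′ ⇔ TreeLe (a ++ e) (a ++ e′)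
TreeLe-cone a e e′ = mk⇔ (++⁺ (Pointwise.refl refl)) (++⁻ {as = a} refl)

TreeLe-commonExtension : TreeLe s u → TreeLe t u → TreeLe s t ⊎ TreeLe t s
TreeLe-commonExtension []         _          = inj₁ []
TreeLe-commonExtension (_ ∷ _)    []         = inj₂ []
TreeLe-commonExtension (refl ∷ p) (refl ∷ q) with TreeLe-commonExtension p q
... | inj₁ s≤t = inj₁ (refl ∷ s≤t)
... | inj₂ t≤s = inj₂ (refl ∷ t≤s)

TreeLe-branch : ∀ u {b b′ s t} → TreeLe (u ++ b ∷ s) (u ++ b′ ∷ t) → b ≡ b′
TreeLe-branch u {b′ = b′} {t = t} p with ++⁻ {as = u} {ds = b′ ∷ t} refl p
... | b≡b′ ∷ _ = b≡b′

PerpLt⇒¬TreeLe : PerpLt s t → ¬ TreeLe s t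
PerpLt⇒¬TreeLe (u , _ , _ , refl , refl) p with TreeLe-branch u p
... | ()

PerpLt⇒¬TreeLe⁻ : PerpLt s t → ¬ TreeLe t s
PerpLt⇒¬TreeLe⁻ (u , _ , _ , refl , refl) p with TreeLe-branch u p
... | ()

PerpLt-∷⁺ : PerpLt s t → PerpLt (b ∷ s) (b ∷ t)
PerpLt-∷⁺ {b = b} (u , s′ , t′ , refl , refl) = b ∷ u , s′ , t′ , refl , refl

PerpLt-∷⁻ : PerpLt (b ∷ s) (b ∷ t) → PerpLt s t
PerpLt-∷⁻ ([] , _ , _ , refl , ())
PerpLt-∷⁻ (_ ∷ u , s′ , t′ , p , q) = u , s′ , t′ , proj₂ (∷-injective p) , proj₂ (∷-injective q)

PerpLe-cone : ∀ a e e′ → PerpLe e e′ ⇔ PerpLe (a ++ e) (a ++ e′)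
PerpLe-cone a e e′ = mk⇔ extend (restrict a)
  where
  extend : PerpLe e e′ → PerpLe (a ++ e) (a ++ e′)
  extend (inj₁ refl) = inj₁ refl
  extend (inj₂ (u , s′ , t′ , refl , refl)) =
    inj₂ (a ++ u , s′ , t′ , sym (++-assoc a u _) , sym (++-assoc a u _))
  restrict : ∀ a → PerpLe (a ++ e) (a ++ e′) → PerpLe e e′
  restrict a (inj₁ eq) = inj₁ (++-cancelˡ a e e′ eq)
  restrict a (inj₂ lt) = inj₂ (cancel a lt)
    where
    cancel : ∀ a → PerpLt (a ++ e) (a ++ e′) → PerpLt e e′
    cancel []      lt = lt
    cancel (_ ∷ a) lt = cancel a (PerpLt-∷⁻ lt)

PerpLt-extendˡ : ∀ e → PerpLt s t → PerpLt (s ++ e) t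
PerpLt-extendˡ e (u , s′ , t′ , refl , refl) = u , s′ ++ e , t′ , ++-assoc u (false ∷ s′) e , refl

¬PerpLt-extension⁻ : ∀ t f → ¬ PerpLt (t ++ f) t
¬PerpLt-extension⁻ _ f (u , s′ , t′ , p , refl)
  with ++-cancelˡ u _ _ (trans (sym p) (++-assoc u (true ∷ t′) f))
... | ()

¬PerpLt-extension⁺ : ∀ t f → ¬ PerpLt t (t ++ f)
¬PerpLt-extension⁺ _ f (u , s′ , t′ , refl , p)
  with ++-cancelˡ u _ _ (trans (sym p) (++-assoc u (false ∷ s′) f))
... | ()

¬PerpLe-properExtension⁻ : ∀ t b e → ¬ PerpLe (t ++ b ∷ e) t
¬PerpLe-properExtension⁻ t b e (inj₁ eq) with ++-identityʳ-unique t (sym eq)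
... | ()
¬PerpLe-properExtension⁻ t b e (inj₂ lt) = ¬PerpLt-extension⁻ t _ lt

¬PerpLe-properExtension⁺ : ∀ t b e → ¬ PerpLe t (t ++ b ∷ e)
¬PerpLe-properExtension⁺ t b e (inj₁ eq) with ++-identityʳ-unique t eq
... | ()
¬PerpLe-properExtension⁺ t b e (inj₂ lt) = ¬PerpLt-extension⁺ t _ lt

data Position : List Bool → List Bool → Set where
  equal : Position s s
  below : ∀ b e → Position s (s ++ b ∷ e)
  above : ∀ b e → Position (t ++ b ∷ e) t
  left  : PerpLt s t → Position s t
  right : PerpLt t s → Position s t

Position-∷ : Position s t → Position (b ∷ s) (b ∷ t)
Position-∷ equal       = equal
Position-∷ (below b e) = below b e
Position-∷ (above b e) = above b e
Position-∷ (left lt)   = left (PerpLt-∷⁺ lt)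
Position-∷ (right lt)  = right (PerpLt-∷⁺ lt)

position : ∀ s t → Position s t
position []          []          = equal
position []          (b ∷ e)     = below b e
position (b ∷ e)     []          = above b e
position (false ∷ s) (true ∷ t)  = left ([] , s , t , refl , refl)
position (true ∷ s)  (false ∷ t) = right ([] , t , s , refl , refl)
position (false ∷ s) (false ∷ t) = Position-∷ (position s t)
position (true ∷ s)  (true ∷ t)  = Position-∷ (position s t)

module _ {x : PartialOrder a ℓ} {X : Carrier x → PartialOrder a ℓ} where

  SumLe-index : ∀ {z z′} → SumLe x X z z′ → _≤_ x (proj₁ z) (proj₁ z′)
  SumLe-index (inside _)     = IsPartialOrder.refl (isPartialOrder x)
  SumLe-index (across i≤j _) = i≤j

  SummandBelow : Carrier x → Carrier x → Set (a ⊔ ℓ)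
  SummandBelow i j = ∀ {z z′} → proj₁ z ≡ i → proj₁ z′ ≡ j → SumLe x X z z′

  SumLe-sameSummand⊎summandBelow : ∀ {z z′} → SumLe x X z z′ →
    proj₁ z ≡ proj₁ z′ ⊎ SummandBelow (proj₁ z) (proj₁ z′)
  SumLe-sameSummand⊎summandBelow (inside _)       = inj₁ refl
  SumLe-sameSummand⊎summandBelow (across i≤j i≢j) = inj₂ λ { refl refl → across i≤j i≢j }

  SumLe-inside⁻ : ∀ {i p q} → SumLe x X (i , p) (i , q) → _≤_ (X i) p q
  SumLe-inside⁻ (inside p≤q)   = p≤q
  SumLe-inside⁻ (across _ i≢i) = ⊥-elim (i≢i refl)

  summand-embeds : ∀ {A : Set c} {R : Rel A r} (φ : A → SumCarrier x X) i →
    (∀ s → proj₁ (φ s) ≡ i) → (∀ s t → R s t ⇔ SumLe x X (φ s) (φ t)) →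
    OrderEmbeds R (_≤_ (X i))
  summand-embeds φ i inSummand emb =
    (λ s → element (φ s) (inSummand s)) ,
    λ s t → ⇔.trans (emb s t) (SumLe-summand (φ s) (φ t) (inSummand s) (inSummand t))
    where
    element : ∀ z → proj₁ z ≡ i → Carrier (X i)
    element (_ , p) refl = p
    SumLe-summand : ∀ z z′ (e : proj₁ z ≡ i) (e′ : proj₁ z′ ≡ i) →
      SumLe x X z z′ ⇔ _≤_ (X i) (element z e) (element z′ e′)
    SumLe-summand (_ , _) (_ , _) refl refl = mk⇔ SumLe-inside⁻ inside

  index-embeds : ∀ {A : Set c} {R : Rel A r} → Reflexive R → DecidableEquality A →
    (φ : A → SumCarrier x X) → (∀ s t → R s t ⇔ SumLe x X (φ s) (φ t)) →
    (∀ s t → proj₁ (φ s) ≡ proj₁ (φ t) → s ≡ t) → OrderEmbeds R (_≤_ x)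
  index-embeds {R = R} R-refl _≟_ φ emb injective =
    proj₁ ∘ φ , λ s t → mk⇔ (SumLe-index ∘ to (emb s t)) (reflect s t)
    where
    reflect : ∀ s t → _≤_ x (proj₁ (φ s)) (proj₁ (φ t)) → R s t
    reflect s t i≤j with s ≟ t
    ... | yes refl = R-refl
    ... | no s≢t   = from (emb s t) (across i≤j (s≢t ∘ injective s t))

module TreeInSum {x : PartialOrder a ℓ} {X : Carrier x → PartialOrder a ℓ}
  (noSummand : ∀ i → ¬ OrderEmbeds TreeLe (_≤_ (X i)))
  (φ : List Bool → SumCarrier x X) (emb : ∀ s t → TreeLe s t ⇔ SumLe x X (φ s) (φ t))
  where

  π : List Bool → Carrier x
  π = proj₁ ∘ φ

  incomparable-separated : ∀ s t → ¬ TreeLe s t → ¬ TreeLe t s → π s ≢ π t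
  incomparable-separated s t s≰t t≰s πs≡πt =
    noSummand (π s) (summand-embeds (φ ∘ (s ++_)) (π s) cone-inSummand
      λ e e′ → ⇔.trans (TreeLe-cone s e e′) (emb _ _))
    where
    cone-inSummand : ∀ e → π (s ++ e) ≡ π s
    cone-inSummand e with SumLe-sameSummand⊎summandBelow (to (emb _ _) (TreeLe-++ s e))
    ... | inj₁ same  = sym same
    ... | inj₂ lower with TreeLe-commonExtension (TreeLe-++ s e)
                            (from (emb t (s ++ e)) (lower (sym πs≡πt) refl))
    ...   | inj₁ s≤t = ⊥-elim (s≰t s≤t)
    ...   | inj₂ t≤s = ⊥-elim (t≰s t≤s)

  -- The sibling s ⌢ (not b) is incomparable with s ⌢ b ⌢ e yet lies above s.
  properExtension-separated : ∀ s b e → π s ≢ π (s ++ b ∷ e)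
  properExtension-separated s b e πs≡πs⁺
    with SumLe-sameSummand⊎summandBelow (to (emb s (s ++ not b ∷ [])) (TreeLe-++ s _))
  ... | inj₁ same  = incomparable-separated (s ++ b ∷ e) (s ++ not b ∷ [])
                       (not-¬ refl ∘ TreeLe-branch s) (not-¬ refl ∘ sym ∘ TreeLe-branch s)
                       (trans (sym πs≡πs⁺) same)
  ... | inj₂ lower = not-¬ refl (TreeLe-branch s (from (emb _ _) (lower (sym πs≡πs⁺) refl)))

  π-injective : ∀ s t → π s ≡ π t → s ≡ t
  π-injective s t πs≡πt with position s t
  ... | equal     = refl
  ... | below b e = ⊥-elim (properExtension-separated s b e πs≡πt)
  ... | above b e = ⊥-elim (properExtension-separated t b e (sym πs≡πt))
  ... | left lt   = ⊥-elim (incomparable-separated s t (PerpLt⇒¬TreeLe lt) (PerpLt⇒¬TreeLe⁻ lt) πs≡πt)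
  ... | right lt  = ⊥-elim (incomparable-separated s t (PerpLt⇒¬TreeLe⁻ lt) (PerpLt⇒¬TreeLe lt) πs≡πt)

  index-embeds-tree : OrderEmbeds TreeLe (_≤_ x)
  index-embeds-tree = index-embeds (fromPointwise (Pointwise.refl refl)) (≡-dec _≟ᵇ_) φ emb π-injective

module PerpInSum {x : PartialOrder a ℓ} {X : Carrier x → PartialOrder a ℓ}
  (noSummand : ∀ i → ¬ OrderEmbeds PerpLe (_≤_ (X i)))
  (φ : List Bool → SumCarrier x X) (emb : ∀ s t → PerpLe s t ⇔ SumLe x X (φ s) (φ t))
  where

  π : List Bool → Carrier x
  π = proj₁ ∘ φ

  lt-separated : ∀ s t → PerpLt s t → π s ≢ π t
  lt-separated s t s<t πs≡πt =
    noSummand (π s) (summand-embeds (φ ∘ (s ++_)) (π s) cone-inSummand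
      λ e e′ → ⇔.trans (PerpLe-cone s e e′) (emb _ _))
    where
    cone-inSummand : ∀ e → π (s ++ e) ≡ π s
    cone-inSummand e with SumLe-sameSummand⊎summandBelow (to (emb _ t) (inj₂ (PerpLt-extendˡ e s<t)))
    ... | inj₁ same  = trans same (sym πs≡πt)
    ... | inj₂ lower with from (emb (s ++ e) s) (lower refl πs≡πt)
    ...   | inj₁ s⁺≡s = cong π s⁺≡s
    ...   | inj₂ s⁺<s = ⊥-elim (¬PerpLt-extension⁻ s e s⁺<s)

  properExtension-separated : ∀ s b e → π s ≢ π (s ++ b ∷ e)
  properExtension-separated s false e πs≡πs⁺
    with SumLe-sameSummand⊎summandBelow (to (emb _ (s ++ true ∷ [])) (inj₂ (s , e , [] , refl , refl)))
  ... | inj₁ same  = lt-separated _ _ (s , e , [] , refl , refl) same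
  ... | inj₂ lower = ¬PerpLe-properExtension⁺ s true [] (from (emb _ _) (lower πs≡πs⁺ refl))
  properExtension-separated s true e πs≡πs⁺
    with SumLe-sameSummand⊎summandBelow (to (emb (s ++ false ∷ []) _) (inj₂ (s , [] , e , refl , refl)))
  ... | inj₁ same  = lt-separated _ _ (s , [] , e , refl , refl) same
  ... | inj₂ lower = ¬PerpLe-properExtension⁻ s false [] (from (emb _ _) (lower refl πs≡πs⁺))

  π-injective : ∀ s t → π s ≡ π t → s ≡ t
  π-injective s t πs≡πt with position s t
  ... | equal     = refl
  ... | below b e = ⊥-elim (properExtension-separated s b e πs≡πt)
  ... | above b e = ⊥-elim (properExtension-separated t b e (sym πs≡πt))
  ... | left lt   = ⊥-elim (lt-separated s t lt πs≡πt)
  ... | right lt  = ⊥-elim (lt-separated t s lt (sym πs≡πt))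

  index-embeds-perp : OrderEmbeds PerpLe (_≤_ x)
  index-embeds-perp = index-embeds (inj₁ refl) (≡-dec _≟ᵇ_) φ emb π-injective

op : PartialOrder a ℓ → PartialOrder a ℓ
op p = record
  { Carrier        = Carrier p
  ; _≤_            = flip (_≤_ p)
  ; isPartialOrder = Flip.isPartialOrder (isPartialOrder p)
  }

SumLe-op : ∀ {x : PartialOrder a ℓ} {X : Carrier x → PartialOrder a ℓ} {z z′} →
  SumLe x X z z′ ⇔ SumLe (op x) (op ∘ X) z′ z
SumLe-op = mk⇔ dualise undualise
  where
  dualise : ∀ {x X z z′} → SumLe {a} {ℓ} x X z z′ → SumLe (op x) (op ∘ X) z′ z
  dualise (inside p≤q)     = inside p≤q
  dualise (across i≤j i≢j) = across i≤j (i≢j ∘ sym)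
  undualise : ∀ {x X z z′} → SumLe {a} {ℓ} (op x) (op ∘ X) z′ z → SumLe x X z z′
  undualise (inside p≤q)     = inside p≤q
  undualise (across i≤j i≢j) = across i≤j (i≢j ∘ sym)

op-embeds : ∀ {A : Set c} {R : Rel A r} (p : PartialOrder a ℓ) →
  OrderEmbeds R (_≤_ (op p)) → OrderEmbeds (flip R) (_≤_ p)
op-embeds p (φ , emb) = φ , λ s t → emb t s

tree-sum : ∀ (x : PartialOrder a ℓ) (X : Carrier x → PartialOrder a ℓ) →
  ¬ OrderEmbeds TreeLe (_≤_ x) → (∀ i → ¬ OrderEmbeds TreeLe (_≤_ (X i))) →
  ¬ OrderEmbeds TreeLe (SumLe x X)
tree-sum x X noIndex noSummand (φ , emb) =
  noIndex (TreeInSum.index-embeds-tree noSummand φ emb)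

lemma7p24 : ∀ {a ℓ} (x : PartialOrder a ℓ) (X : Carrier x → PartialOrder a ℓ)
    (y : WhichY) →
    ¬ OrderEmbeds (YLe y) (_≤_ x) →
    (∀ i → ¬ OrderEmbeds (YLe y) (_≤_ (X i))) →
    ¬ OrderEmbeds (YLe y) (SumLe x X)
lemma7p24 x X tree = tree-sum x X
lemma7p24 x X revTree noIndex noSummand (φ , emb) =
  tree-sum (op x) (op ∘ X) (noIndex ∘ op-embeds x) (λ i → noSummand i ∘ op-embeds (X i))
    (φ , λ s t → ⇔.trans (emb t s) SumLe-op)
lemma7p24 x X perp noIndex noSummand (φ , emb) =
  noIndex (PerpInSum.index-embeds-perp noSummand φ emb)
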